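{- Let $n\in\{1,2\}$ and let $A\subset\mathbb{F}_5^n$ be sum-free with $|A|>1.2\cdot 5^{n-1}$. Then there exist a subspace $V<\mathbb{F}_5^n$ of co-dimension $1$ and $w\in\mathbb{F}_5^n\setminus V$ such that $A\subset\{2w,3w\}+V$.
   Context: A set $A$ is sum-free if there are no $a,b,c\in A$ with $a+b=c$. -}

module Defs where

open import Data.Nat using (ℕ; zero; suc; _+_; _*_; _∸_; _^_; _<_)
open import Data.Nat.DivMod using (_mod_)
open import Data.Fin using (Fin; toℕ)
open import Data.Vec using (Vec; []; _∷_; zipWith; map; replicate; foldr)
open import Data.List using (List)
open import Data.List.Membership.Propositional using (_∈_)
open import Data.List.Relation.Unary.All using (All)
open import Data.List.Relation.Unary.Unique.Propositional using (Unique)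
open import Data.Product using (Σ; ∃; _×_)
open import Data.Sum using (_⊎_)
open import Relation.Binary.PropositionalEquality using (_≡_; _≢_)

F5 : Set
F5 = Fin 5

_+₅_ : F5 → F5 → F5
a +₅ b = (toℕ a + toℕ b) mod 5

_*₅_ : F5 → F5 → F5
a *₅ b = (toℕ a * toℕ b) mod 5

F5^ : ℕ → Set
F5^ n = Vec F5 n

0ᵛ : ∀ {n} → F5^ n
0ᵛ = replicate _ Data.Fin.zero

_+ᵛ_ : ∀ {n} → F5^ n → F5^ n → F5^ n
_+ᵛ_ = zipWith _+₅_

_·ᵛ_ : ∀ {n} → F5 → F5^ n → F5^ n
c ·ᵛ v = map (c *₅_) v

two three : F5
two = Data.Fin.suc (Data.Fin.suc Data.Fin.zero)
three = Data.Fin.suc (Data.Fin.suc (Data.Fin.suc Data.Fin.zero))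

lincomb : ∀ {n k} → Vec F5 k → Vec (F5^ n) k → F5^ n
lincomb [] [] = 0ᵛ
lincomb (c ∷ cs) (v ∷ vs) = (c ·ᵛ v) +ᵛ lincomb cs vs

record IsSubspace {n : ℕ} (V : F5^ n → Set) : Set where
  field
    zero∈ : V 0ᵛ
    +-closed : ∀ {u v} → V u → V v → V (u +ᵛ v)
    ·-closed : ∀ c {v} → V v → V (c ·ᵛ v)

record IsBasis {n d : ℕ} (V : F5^ n → Set) (b : Vec (F5^ n) d) : Set where
  field
    inV : ∀ cs → V (lincomb cs b)
    spanning : ∀ {v} → V v → ∃ λ cs → lincomb cs b ≡ v
    independent : ∀ cs → lincomb cs b ≡ 0ᵛ → cs ≡ replicate d Data.Fin.zero

HasDim : ∀ {n} → (F5^ n → Set) → ℕ → Set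
HasDim {n} V d = Σ (Vec (F5^ n) d) (IsBasis V)

IsHyperplane : ∀ {n} → (F5^ n → Set) → Set
IsHyperplane {n} V = IsSubspace V × HasDim V (n ∸ 1)

SumFree : ∀ {n} → List (F5^ n) → Set
SumFree A = ∀ {a b c} → a ∈ A → b ∈ A → c ∈ A → a +ᵛ b ≢ c

In2w3w+V : ∀ {n} → (F5^ n → Set) → F5^ n → F5^ n → Set
In2w3w+V V w x = ∃ λ v → V v × (x ≡ (two ·ᵛ w) +ᵛ v ⊎ x ≡ (three ·ᵛ w) +ᵛ v)

-- For n ≤ 2 the theorem is a finite check: every sum-free subset of F₅ with at least 2
-- elements, and every sum-free subset of F₅² with at least 7, lies in some {2w, 3w} + V.
-- A duplicate-free A is replaced by the sublist of a fixed enumeration of F₅ⁿ with the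
-- same elements, which has the same length, and the sum-free sublists of the enumeration
-- are generated by a backtracking search that abandons a partial choice once it is no
-- longer sum-free or can no longer reach the required size.
module Submission where

open import Defs
open import Data.Nat using (ℕ; zero; suc; _*_; _^_; _∸_; _<_; _≤_; _+_; _<ᵇ_)
open import Data.Nat.Properties using (≤-trans; <-trans; <-≤-trans; <-irrefl; n<1+n; *-cancelˡ-<; +-monoʳ-≤; <ᵇ⇒<)
open import Data.Bool using (Bool; true; _∧_; _∨_; if_then_else_; T)
open import Data.Bool.Properties using (T-∧; T-∨)
open import Data.Empty using (⊥-elim)
open import Data.Fin using (#_) renaming (zero to 0F)
open import Data.Fin.Properties using (_≟_; all?; any?)
open import Data.Vec using ([]; _∷_)
open import Data.Vec.Properties using (∷-injective; ∷-injectiveˡ; ∷-injectiveʳ) renaming (≡-dec to ≡-decᵛ)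
open import Data.List using (List; []; _∷_; _++_; [_]; length; allFin; cartesianProductWith; concatMap; filter)
open import Data.List.Properties using (length-++; ++-assoc; ++-identityʳ)
open import Data.List.Membership.Propositional using (_∈_; _∉_)
open import Data.List.Membership.Propositional.Properties using (∈-++⁺ˡ; ∈-++⁺ʳ; ∈-allFin; ∈-cartesianProductWith⁺; ∈-filter⁺; ∈-filter⁻)
open import Data.List.Membership.Propositional.Properties.WithK using (unique∧set⇒bag)
open import Data.List.Relation.Unary.Any as Any using (Any; here)
open import Data.List.Relation.Unary.All as All using (All)
open import Data.List.Relation.Unary.Unique.Propositional using (Unique)
open import Data.List.Relation.Unary.AllPairs using ([]; _∷_)
open import Data.List.Relation.Unary.Unique.Propositional.Properties using (cartesianProductWith⁺; allFin⁺; filter⁺)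
open import Data.List.Relation.Binary.Subset.Propositional using () renaming (_⊆_ to _⊆ˢ_)
open import Data.List.Relation.Binary.Subset.Propositional.Properties using (All-resp-⊇)
open import Data.List.Relation.Binary.Sublist.Propositional using (_⊆_; []; _∷_; _∷ʳ_)
open import Data.List.Relation.Binary.Sublist.Propositional.Properties using (filter-⊆; length-mono-≤)
open import Data.List.Relation.Binary.BagAndSetEquality using (_∼[_]_; set; ∼bag⇒↭)
open import Data.List.Relation.Binary.Permutation.Propositional.Properties using (↭-length)
open import Data.Product using (Σ; ∃; _×_; _,_; proj₁; proj₂)
open import Data.Sum using (_⊎_; inj₁; inj₂)
open import Function using (_∘_; mk⇔; Equivalence)
open import Relation.Nullary using (¬_; Dec; yes; no; isYes; map′; ¬?)
open import Relation.Nullary.Decidable using (toWitness; _×-dec_; _⊎-dec_; _→-dec_)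
open import Relation.Unary using (Decidable)
open import Relation.Binary.PropositionalEquality using (_≡_; _≢_; refl; sym; trans; cong₂; subst)

infix 4 _≟ᵛ_
_≟ᵛ_ : ∀ {n} (u v : F5^ n) → Dec (u ≡ v)
_≟ᵛ_ = ≡-decᵛ _≟_

+₅-identityʳ : ∀ a → a +₅ 0F ≡ a
+₅-identityʳ = toWitness {a? = all? λ a → a +₅ 0F ≟ a} _

*₅-zeroˡ : ∀ a → 0F *₅ a ≡ 0F
*₅-zeroˡ = toWitness {a? = all? λ a → 0F *₅ a ≟ 0F} _

*₅-zeroʳ : ∀ a → a *₅ 0F ≡ 0F
*₅-zeroʳ = toWitness {a? = all? λ a → a *₅ 0F ≟ 0F} _

*₅-distribʳ-+₅ : ∀ x a b → (a *₅ x) +₅ (b *₅ x) ≡ (a +₅ b) *₅ x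
*₅-distribʳ-+₅ = toWitness
  {a? = all? λ x → all? λ a → all? λ b → (a *₅ x) +₅ (b *₅ x) ≟ (a +₅ b) *₅ x} _

*₅-assoc : ∀ a b x → a *₅ (b *₅ x) ≡ (a *₅ b) *₅ x
*₅-assoc = toWitness
  {a? = all? λ a → all? λ b → all? λ x → a *₅ (b *₅ x) ≟ (a *₅ b) *₅ x} _

*₅-zero-divisor : ∀ a b → a *₅ b ≡ 0F → a ≡ 0F ⊎ b ≡ 0F
*₅-zero-divisor = toWitness
  {a? = all? λ a → all? λ b → (a *₅ b ≟ 0F) →-dec ((a ≟ 0F) ⊎-dec (b ≟ 0F))} _

+ᵛ-identityʳ : ∀ {n} (v : F5^ n) → v +ᵛ 0ᵛ ≡ v
+ᵛ-identityʳ [] = refl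
+ᵛ-identityʳ (a ∷ v) = cong₂ _∷_ (+₅-identityʳ a) (+ᵛ-identityʳ v)

·ᵛ-zeroˡ : ∀ {n} (v : F5^ n) → 0F ·ᵛ v ≡ 0ᵛ
·ᵛ-zeroˡ [] = refl
·ᵛ-zeroˡ (a ∷ v) = cong₂ _∷_ (*₅-zeroˡ a) (·ᵛ-zeroˡ v)

·ᵛ-zeroʳ : ∀ n c → c ·ᵛ 0ᵛ {n} ≡ 0ᵛ
·ᵛ-zeroʳ zero c = refl
·ᵛ-zeroʳ (suc n) c = cong₂ _∷_ (*₅-zeroʳ c) (·ᵛ-zeroʳ n c)

·ᵛ-distribʳ-+₅ : ∀ {n} (v : F5^ n) a b → (a ·ᵛ v) +ᵛ (b ·ᵛ v) ≡ (a +₅ b) ·ᵛ v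
·ᵛ-distribʳ-+₅ [] a b = refl
·ᵛ-distribʳ-+₅ (x ∷ v) a b = cong₂ _∷_ (*₅-distribʳ-+₅ x a b) (·ᵛ-distribʳ-+₅ v a b)

·ᵛ-assoc : ∀ {n} a b (v : F5^ n) → a ·ᵛ (b ·ᵛ v) ≡ (a *₅ b) ·ᵛ v
·ᵛ-assoc a b [] = refl
·ᵛ-assoc a b (x ∷ v) = cong₂ _∷_ (*₅-assoc a b x) (·ᵛ-assoc a b v)

·ᵛ-zero-divisor : ∀ {n} c (v : F5^ n) → c ·ᵛ v ≡ 0ᵛ → c ≡ 0F ⊎ v ≡ 0ᵛ
·ᵛ-zero-divisor c [] _ = inj₂ refl
·ᵛ-zero-divisor c (x ∷ v) cv≡0 with *₅-zero-divisor c x (∷-injectiveˡ cv≡0)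
... | inj₁ c≡0 = inj₁ c≡0
... | inj₂ refl with ·ᵛ-zero-divisor c v (∷-injectiveʳ cv≡0)
...   | inj₁ c≡0 = inj₁ c≡0
...   | inj₂ refl = inj₂ refl

Line : ∀ {n} → F5^ n → F5^ n → Set
Line d x = ∃ λ c → c ·ᵛ d ≡ x

Line-isSubspace : ∀ {n} (d : F5^ n) → IsSubspace (Line d)
Line-isSubspace d = record
  { zero∈ = 0F , ·ᵛ-zeroˡ d
  ; +-closed = λ { (a , refl) (b , refl) → a +₅ b , sym (·ᵛ-distribʳ-+₅ d a b) }
  ; ·-closed = λ { c (a , refl) → c *₅ a , sym (·ᵛ-assoc c a d) }
  }

Line-basis : ∀ {n} {d : F5^ n} → d ≢ 0ᵛ → IsBasis (Line d) (d ∷ [])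
Line-basis {d = d} d≢0 = record
  { inV = λ { (c ∷ []) → c , sym (+ᵛ-identityʳ (c ·ᵛ d)) }
  ; spanning = λ { (c , refl) → c ∷ [] , +ᵛ-identityʳ (c ·ᵛ d) }
  ; independent = λ { (c ∷ []) cd+0≡0 → independent c (trans (sym (+ᵛ-identityʳ _)) cd+0≡0) }
  }
  where
    independent : ∀ c → c ·ᵛ d ≡ 0ᵛ → c ∷ [] ≡ 0F ∷ []
    independent c cd≡0 with ·ᵛ-zero-divisor c d cd≡0
    ... | inj₁ refl = refl
    ... | inj₂ d≡0 = ⊥-elim (d≢0 d≡0)

Line-0ᵛ-basis : ∀ {n} → IsBasis (Line (0ᵛ {n})) []
Line-0ᵛ-basis {n} = record
  { inV = λ { [] → 0F , ·ᵛ-zeroʳ n 0F }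
  ; spanning = λ { (c , refl) → [] , sym (·ᵛ-zeroʳ n c) }
  ; independent = λ { [] _ → refl }
  }

Line? : ∀ {n} (d x : F5^ n) → Dec (Line d x)
Line? d x = any? λ c → c ·ᵛ d ≟ᵛ x

In2w3w+Line? : ∀ {n} (d w x : F5^ n) → Dec (In2w3w+V (Line d) w x)
In2w3w+Line? d w x = map′
  (λ { (c , e) → c ·ᵛ d , (c , refl) , e })
  (λ { (_ , (c , refl) , e) → c , e })
  (any? λ c → (x ≟ᵛ (two ·ᵛ w) +ᵛ (c ·ᵛ d)) ⊎-dec (x ≟ᵛ (three ·ᵛ w) +ᵛ (c ·ᵛ d)))

SumFree-anti-mono : ∀ {n} {S T : List (F5^ n)} → S ⊆ˢ T → SumFree T → SumFree S
SumFree-anti-mono S⊆T sf a∈ b∈ c∈ = sf (S⊆T a∈) (S⊆T b∈) (S⊆T c∈)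

-- Only necessity (SumFree⇒SumFreeThrough) matters for soundness of the search; by
-- commutativity of +ᵛ the check is also sufficient, so the search visits only sum-free lists.
SumFreeThrough : ∀ {n} → F5^ n → List (F5^ n) → Set
SumFreeThrough x S = All (λ a → All (λ b → a +ᵛ b ≢ x) S × x +ᵛ a ∉ S) S

sumFreeThrough? : ∀ {n} (x : F5^ n) → Decidable (SumFreeThrough x)
sumFreeThrough? x S =
  All.all? (λ a → All.all? (λ b → ¬? (a +ᵛ b ≟ᵛ x)) S ×-dec ¬? (Any.any? (x +ᵛ a ≟ᵛ_) S)) S

SumFree⇒SumFreeThrough : ∀ {n} {x : F5^ n} {S} → SumFree S → x ∈ S → SumFreeThrough x S
SumFree⇒SumFreeThrough sf x∈ = All.tabulate λ a∈ → All.tabulate (λ b∈ → sf a∈ b∈ x∈) , λ x+a∈ → sf x∈ a∈ x+a∈ refl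

length-++-⊆ : ∀ {A : Set} {S T : List A} (L : List A) → S ⊆ T → length (L ++ S) ≤ length L + length T
length-++-⊆ {S = S} L S⊆T = subst (_≤ _) (sym (length-++ L {S})) (+-monoʳ-≤ (length L) (length-mono-≤ S⊆T))

module Search {n} {P : List (F5^ n) → Set} (P? : Decidable P) (k : ℕ) where

  search branch : (remaining chosen : List (F5^ n)) → Bool
  search rem ch = (length ch + length rem <ᵇ k) ∨ branch rem ch
  branch [] ch = isYes (P? ch)
  branch (x ∷ rem) ch = search rem ch ∧
    (if isYes (sumFreeThrough? x (ch ++ [ x ])) then search rem (ch ++ [ x ]) else true)

  search-sound : ∀ rem ch → T (search rem ch) →
    ∀ {S} → S ⊆ rem → SumFree (ch ++ S) → k ≤ length (ch ++ S) → P (ch ++ S)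
  branch-sound : ∀ rem ch → T (branch rem ch) →
    ∀ {S} → S ⊆ rem → SumFree (ch ++ S) → k ≤ length (ch ++ S) → P (ch ++ S)
  search-sound rem ch ok S⊆ sf k≤ with Equivalence.to (T-∨ {length ch + length rem <ᵇ k}) ok
  ... | inj₁ short = ⊥-elim (<-irrefl refl
          (<-≤-trans (<ᵇ⇒< _ k short) (≤-trans k≤ (length-++-⊆ ch S⊆))))
  ... | inj₂ ok′ = branch-sound rem ch ok′ S⊆ sf k≤
  branch-sound [] ch ok [] sf k≤ = subst P (sym (++-identityʳ ch)) (toWitness {a? = P? ch} ok)
  branch-sound (x ∷ rem) ch ok (x ∷ʳ S⊆) sf k≤ =
    search-sound rem ch (proj₁ (Equivalence.to (T-∧ {search rem ch}) ok)) S⊆ sf k≤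
  branch-sound (x ∷ rem) ch ok (_∷_ {xs = S} refl S⊆) sf k≤ with sumFreeThrough? x (ch ++ [ x ])
  ... | yes _ = subst P assoc
          (search-sound rem (ch ++ [ x ]) (proj₂ (Equivalence.to (T-∧ {search rem ch}) ok)) S⊆
            (subst SumFree (sym assoc) sf) (subst (λ L → k ≤ length L) (sym assoc) k≤))
    where assoc = ++-assoc ch [ x ] S
  ... | no ¬sf = ⊥-elim (¬sf (SumFree⇒SumFreeThrough
          (SumFree-anti-mono ∈-++⁺ˡ (subst SumFree (sym (++-assoc ch [ x ] S)) sf)) (∈-++⁺ʳ ch (here refl))))

vectors : ∀ n → List (F5^ n)
vectors zero = [ [] ]
vectors (suc n) = cartesianProductWith _∷_ (allFin 5) (vectors n)

∈-vectors : ∀ {n} (v : F5^ n) → v ∈ vectors n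
∈-vectors [] = here refl
∈-vectors (a ∷ v) = ∈-cartesianProductWith⁺ _∷_ (∈-allFin a) (∈-vectors v)

vectors-unique : ∀ n → Unique (vectors n)
vectors-unique zero = All.[] ∷ []
vectors-unique (suc n) = cartesianProductWith⁺ _∷_ ∷-injective (allFin⁺ 5) (vectors-unique n)

module _ {n} {P : List (F5^ n) → Set} (P? : Decidable P)
         (P-anti-mono : ∀ {S T} → S ⊆ˢ T → P T → P S) (k : ℕ) where
  open Search P? k
  open import Data.List.Membership.DecPropositional (_≟ᵛ_ {n}) using (_∈?_)

  search-vectors-sound : T (search (vectors n) []) →
    ∀ A → Unique A → SumFree A → k ≤ length A → P A
  search-vectors-sound ok A unique sf k≤ =
    P-anti-mono (Equivalence.to A∼S)
      (search-sound (vectors n) [] ok (filter-⊆ (_∈? A) (vectors n)) sfS k≤S)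
    where
      S = filter (_∈? A) (vectors n)
      A∼S : A ∼[ set ] S
      A∼S = mk⇔ (∈-filter⁺ (_∈? A) (∈-vectors _)) (proj₂ ∘ ∈-filter⁻ (_∈? A) {xs = vectors n})
      sfS : SumFree S
      sfS = SumFree-anti-mono (Equivalence.from A∼S) sf
      k≤S : k ≤ length S
      k≤S = subst (k ≤_) (↭-length (∼bag⇒↭ (unique∧set⇒bag unique S-unique A∼S))) k≤
        where S-unique = filter⁺ (_∈? A) {vectors n} (vectors-unique n)

CoveredBy : ∀ {n} → List (F5^ n × F5^ n) → List (F5^ n) → Set
CoveredBy dws A = Any (λ { (d , w) → All (In2w3w+V (Line d) w) A }) dws

coveredBy? : ∀ {n} (dws : List (F5^ n × F5^ n)) → Decidable (CoveredBy dws)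
coveredBy? dws A = Any.any? (λ { (d , w) → All.all? (In2w3w+Line? d w) A }) dws

CoveredBy-anti-mono : ∀ {n} {dws : List (F5^ n × F5^ n)} {S T} →
  S ⊆ˢ T → CoveredBy dws T → CoveredBy dws S
CoveredBy-anti-mono S⊆T = Any.map (All-resp-⊇ S⊆T)

SplitsAlongHyperplane : ∀ {n} → F5^ n × F5^ n → Set
SplitsAlongHyperplane (d , w) = IsHyperplane (Line d) × ¬ Line d w

CoveredBy⇒split : ∀ {n} {dws : List (F5^ n × F5^ n)} → All SplitsAlongHyperplane dws →
  ∀ {A} → CoveredBy dws A →
  Σ (F5^ n → Set) λ V → IsHyperplane V × Σ (F5^ n) λ w → ¬ V w × All (In2w3w+V V w) A
CoveredBy⇒split valid covered =
  All.lookupWith (λ { {d , w} (hyperplane , w∉) A⊆ → Line d , hyperplane , w , w∉ , A⊆ }) valid covered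

-- For w′ = 2w one has {2w′, 3w′} = {4w, w}, so the two entries give both sum-free
-- unions of two cosets of Line d.
bothCosetPairs : ∀ {n} → F5^ n × F5^ n → List (F5^ n × F5^ n)
bothCosetPairs (d , w) = (d , w) ∷ (d , two ·ᵛ w) ∷ []

hyperplanes₁ : List (F5^ 1 × F5^ 1)
hyperplanes₁ = bothCosetPairs (0ᵛ , # 1 ∷ [])

hyperplanes₁-valid : All SplitsAlongHyperplane hyperplanes₁
hyperplanes₁-valid = All.map (λ { (refl , w∉) → (Line-isSubspace 0ᵛ , [] , Line-0ᵛ-basis) , w∉ })
  (toWitness {a? = All.all? (λ { (d , w) → (d ≟ᵛ 0ᵛ) ×-dec ¬? (Line? d w) }) hyperplanes₁} _)

hyperplanes₂ : List (F5^ 2 × F5^ 2)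
hyperplanes₂ =
  bothCosetPairs (e₀₁ , e₁₀) ++ concatMap (λ c → bothCosetPairs ((# 1 ∷ c ∷ []) , e₀₁)) (allFin 5)
  where
    e₁₀ e₀₁ : F5^ 2
    e₁₀ = # 1 ∷ # 0 ∷ []
    e₀₁ = # 0 ∷ # 1 ∷ []

hyperplanes₂-valid : All SplitsAlongHyperplane hyperplanes₂
hyperplanes₂-valid = All.map (λ { (d≢0 , w∉) → (Line-isSubspace _ , _ , Line-basis d≢0) , w∉ })
  (toWitness {a? = All.all? (λ { (d , w) → ¬? (d ≟ᵛ 0ᵛ) ×-dec ¬? (Line? d w) }) hyperplanes₂} _)

covered₁ : ∀ A → Unique A → SumFree A → 2 ≤ length A → CoveredBy hyperplanes₁ A
covered₁ = search-vectors-sound (coveredBy? hyperplanes₁) CoveredBy-anti-mono 2 _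

covered₂ : ∀ A → Unique A → SumFree A → 7 ≤ length A → CoveredBy hyperplanes₂ A
covered₂ = search-vectors-sound (coveredBy? hyperplanes₂) CoveredBy-anti-mono 7 _

lemma3p3 : (n : ℕ) → n ≡ 1 ⊎ n ≡ 2 →
    (A : List (F5^ n)) → Unique A → SumFree A →
    6 * 5 ^ (n ∸ 1) < 5 * length A →
    Σ (F5^ n → Set) λ V → IsHyperplane V ×
      Σ (F5^ n) λ w → ¬ V w × All (In2w3w+V V w) A
lemma3p3 _ (inj₁ refl) A unique sf large =
  CoveredBy⇒split hyperplanes₁-valid (covered₁ A unique sf (*-cancelˡ-< 5 1 _ (<-trans (n<1+n 5) large)))
lemma3p3 _ (inj₂ refl) A unique sf large =
  CoveredBy⇒split hyperplanes₂-valid (covered₂ A unique sf (*-cancelˡ-< 5 6 _ large))
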